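{- Let $G$ be a braced ribbon-cutting graph such that every two distinct vertices are separated by a ribbon of $G$. Then the bracing graph of $G$ is connected if and only if $G$ does not have a cartesian NAC-coloring.
   Context: For a graph $H$, two edges are related if they are opposite edges of a 4-cycle subgraph of $H$; a ribbon of $H$ is an equivalence class of the reflexive–transitive closure of this relation. A ribbon-cutting graph is a connected graph in which every ribbon is an edge cut (its removal disconnects the graph). A braced ribbon-cutting graph is a graph $G=(V_G,E_c\cup E_d)$, where $E_c,E_d$ are non-empty disjoint sets, $(V_G,E_c)$ is ribbon-cutting, and every edge of $E_d$ (a brace) is a diagonal $u_1u_3$ of some 4-cycle $(u_1,u_2,u_3,u_4)$ of $(V_G,E_c)$. The ribbons of $G$ are the sets $r\cup\{u_1u_3\in E_d: \exists\text{ 4-cycle }(u_1,u_2,u_3,u_4)\text{ of }(V_G,E_c)\text{ with }u_1u_2,u_3u_4\in r\}$ for ribbons $r$ of $(V_G,E_c)$. A ribbon $r$ of $G$ separates $x,y$ if they lie in different connected components of $(V_G,(E_c\cup E_d)\setminus r)$. The ribbon graph $\Gamma$ of $G$ has the ribbons of $G$ as vertices, two ribbons $r_1,r_2$ being adjacent iff there is a 4-cycle $(u_1,u_2,u_3,u_4)$ in $G$ with $u_1u_2,u_3u_4\in r_1$ and $u_1u_4,u_2u_3\in r_2$. The bracing graph is the subgraph $(V_\Gamma,E_b)$ with $E_b=\{r_1r_2\in E_\Gamma: r_1\cap r_2\text{ is non-empty (and hence consists of braces)}\}$. A NAC-coloring of $G$ is a surjective map $\delta:E_G\to\{\text{red},\text{blue}\}$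 such that every cycle is monochromatic or contains at least two edges of each color; it is cartesian if no two distinct vertices are connected by both a red path and a blue path. -}

module Defs where

open import Data.Nat using (ℕ; zero; suc; _+_; _≤_)
open import Data.Fin using (Fin)
open import Data.Bool using (Bool; true; false; T; _∨_; if_then_else_)
open import Data.Product using (Σ; ∃; ∃-syntax; _×_; _,_; proj₁; proj₂)
open import Data.Sum using (_⊎_)
open import Data.List using (List; []; _∷_; _++_; [_]; zip; length)
open import Data.List.Relation.Unary.All using (All)
open import Data.List.Relation.Unary.Unique.Propositional using (Unique)
open import Relation.Nullary using (¬_)
open import Relation.Binary.PropositionalEquality using (_≡_; _≢_)
open import Relation.Binary.Construct.Closure.ReflexiveTransitive using (Star)

-- Edges are
-- handled as ordered pairs; an unordered edge {u,v} corresponds to both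
-- (u , v) and (v , u).
AdjRel : ℕ → Set
AdjRel n = Fin n → Fin n → Bool

Pair : ℕ → Set
Pair n = Fin n × Fin n

module _ {n : ℕ} where

  IsSimple : AdjRel n → Set
  IsSimple E = (∀ u v → E u v ≡ E v u) × (∀ u → E u u ≡ false)

  IsEdge : AdjRel n → Pair n → Set
  IsEdge E e = T (E (proj₁ e) (proj₂ e))

  Cyc4 : AdjRel n → Fin n → Fin n → Fin n → Fin n → Set
  Cyc4 E a b c d =
    a ≢ b × a ≢ c × a ≢ d × b ≢ c × b ≢ d × c ≢ d ×
    T (E a b) × T (E b c) × T (E c d) × T (E d a)

  data RibStep (E : AdjRel n) : Pair n → Pair n → Set where
    opp  : ∀ {a b c d} → Cyc4 E a b c d → RibStep E (a , b) (c , d)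
    flip : ∀ {a b} → RibStep E (a , b) (b , a)

  RibRel : AdjRel n → Pair n → Pair n → Set
  RibRel E = Star (RibStep E)

  InRib : AdjRel n → Pair n → Fin n → Fin n → Set
  InRib E e a b = T (E a b) × RibRel E e (a , b)

  Connected : (Fin n → Fin n → Set) → Set
  Connected P = ∀ u v → Star P u v

  Without : AdjRel n → (Fin n → Fin n → Set) → Fin n → Fin n → Set
  Without E R a b = T (E a b) × ¬ R a b

  RibbonCutting : AdjRel n → Set
  RibbonCutting E =
    Connected (λ a b → T (E a b)) ×
    (∀ e → IsEdge E e → ¬ Connected (Without E (InRib E e)))

record BracedRibbonCutting (n : ℕ) : Set where
  field
    Ec Ed      : AdjRel n
    Ec-simple  : IsSimple Ec
    Ed-simple  : IsSimple Ed
    Ec-nonempty : ∃[ u ] ∃[ v ] T (Ec u v)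
    Ed-nonempty : ∃[ u ] ∃[ v ] T (Ed u v)
    disjoint   : ∀ u v → ¬ (T (Ec u v) × T (Ed u v))
    ribbonCutting : RibbonCutting Ec
    braces     : ∀ u v → T (Ed u v) → ∃[ x ] ∃[ y ] Cyc4 Ec u x v y

module _ {n : ℕ} (G : BracedRibbonCutting n) where
  open BracedRibbonCutting G

  GE : AdjRel n
  GE a b = Ec a b ∨ Ed a b

  -- the ribbon of G determined by the ribbon of (V, Ec) containing e
  GRib : Pair n → Fin n → Fin n → Set
  GRib e a b =
    InRib Ec e a b ⊎
    (T (Ed a b) × ∃[ x ] ∃[ y ] (Cyc4 Ec a x b y × InRib Ec e a x × InRib Ec e b y))

  Separates : Pair n → Fin n → Fin n → Set
  Separates e x y = ¬ Star (Without GE (GRib e)) x y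

  RibbonAdj : Pair n → Pair n → Set
  RibbonAdj e₁ e₂ = ∃[ u₁ ] ∃[ u₂ ] ∃[ u₃ ] ∃[ u₄ ]
    (Cyc4 GE u₁ u₂ u₃ u₄ ×
     GRib e₁ u₁ u₂ × GRib e₁ u₃ u₄ × GRib e₂ u₁ u₄ × GRib e₂ u₂ u₃)

  BracingAdj : Pair n → Pair n → Set
  BracingAdj e₁ e₂ = RibbonAdj e₁ e₂ × ∃[ a ] ∃[ b ] (GRib e₁ a b × GRib e₂ a b)

  -- the bracing graph is connected: any two ribbons (given by representative
  -- Ec-edges) are joined by a walk in the bracing graph; steps between two
  -- representatives of the same ribbon are free.
  BracingConnected : Set
  BracingConnected = ∀ e₁ e₂ → IsEdge Ec e₁ → IsEdge Ec e₂ →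
    Star (λ f g → IsEdge Ec f × IsEdge Ec g × (BracingAdj f g ⊎ RibRel Ec f g)) e₁ e₂

-- Colorings: true = red, false = blue
module _ {n : ℕ} where

  cycleEdges : List (Fin n) → List (Pair n)
  cycleEdges [] = []
  cycleEdges (v ∷ vs) = zip (v ∷ vs) (vs ++ [ v ])

  IsCycle : AdjRel n → List (Fin n) → Set
  IsCycle E vs = 3 ≤ length vs × Unique vs × All (IsEdge E) (cycleEdges vs)

  countRed : (Fin n → Fin n → Bool) → List (Pair n) → ℕ
  countRed δ [] = 0
  countRed δ ((u , v) ∷ ps) = (if δ u v then 1 else 0) + countRed δ ps

  countBlue : (Fin n → Fin n → Bool) → List (Pair n) → ℕ
  countBlue δ [] = 0
  countBlue δ ((u , v) ∷ ps) = (if δ u v then 0 else 1) + countBlue δ ps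

  IsNAC : AdjRel n → (Fin n → Fin n → Bool) → Set
  IsNAC E δ =
    (∀ u v → T (E u v) → δ u v ≡ δ v u) ×
    (∃[ u ] ∃[ v ] (T (E u v) × δ u v ≡ true)) ×
    (∃[ u ] ∃[ v ] (T (E u v) × δ u v ≡ false)) ×
    (∀ vs → IsCycle E vs →
       let es = cycleEdges vs in
       countRed δ es ≡ 0 ⊎ countBlue δ es ≡ 0 ⊎ (2 ≤ countRed δ es × 2 ≤ countBlue δ es))

  ColEdge : AdjRel n → (Fin n → Fin n → Bool) → Bool → Fin n → Fin n → Set
  ColEdge E δ c a b = T (E a b) × δ a b ≡ c

  IsCartesian : AdjRel n → (Fin n → Fin n → Bool) → Set
  IsCartesian E δ = ∀ u v → u ≢ v →
    ¬ (Star (ColEdge E δ true) u v × Star (ColEdge E δ false) u v)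

-- In a NAC-colouring a 4-cycle is monochromatic or has two edges of each colour; were the two red
-- edges adjacent, the halves of the cycle would be a red and a blue path between opposite corners,
-- which a cartesian colouring forbids.  So a cartesian NAC-colouring is constant on every ribbon.
-- A brace closes a triangle with two sides of a braced 4-cycle, so it has the colour of their
-- ribbon; hence ribbons sharing a brace have the same colour, and a connected bracing graph would
-- make the colouring constant.
-- Conversely, if the bracing graph is disconnected, colour an edge red iff its ribbon lies in the
-- bracing component of a fixed ribbon.  A monochromatic walk avoids every ribbon of the other colour,
-- and some ribbon separates any two distinct vertices.  So a red and a blue path between the same
-- two vertices are impossible, and so is a cycle with a single edge ab of one colour: whatever the
-- colour of a ribbon separating a and b, either the edge ab or the rest of the cycle avoids it.
module Submission where

open import Defs
open import Data.Nat using (ℕ; zero; suc; _+_; _≤_; z≤n; s≤s)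
open import Data.Nat.Properties using (suc-injective)
open import Data.Fin using (Fin) renaming (_≟_ to _≟ᶠ_)
open import Data.Fin.Properties using (any?)
open import Data.Bool using (Bool; true; false; T; _∨_; not; if_then_else_) renaming (_≟_ to _≟ᵇ_)
open import Data.Bool.Properties using (T-∨; not-¬)
open import Data.Product using (∃-syntax; _×_; _,_; proj₁; proj₂; uncurry)
open import Data.Product.Properties using (≡-dec)
open import Data.Sum using (_⊎_; inj₁; inj₂; [_,_]′)
open import Data.Empty using (⊥-elim)
open import Data.List using (List; []; _∷_; _++_; [_]; zip; allFin; cartesianProduct)
open import Data.List.Membership.Propositional using (_∈_)
open import Data.List.Membership.Propositional.Properties using (∈-allFin; ∈-cartesianProduct⁺)
open import Data.List.Relation.Unary.All using (All; []; _∷_)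
open import Data.List.Relation.Unary.AllPairs using ([]; _∷_)
open import Data.List.Relation.Unary.Any using (here; there)
open import Function using (_∘_)
open import Function.Bundles using (_⇔_; mk⇔; Equivalence)
open import Relation.Binary.Definitions using (DecidableEquality)
open import Relation.Binary.PropositionalEquality
  using (_≡_; _≢_; refl; sym; trans; subst; cong₂; ≢-sym; module ≡-Reasoning)
open import Relation.Binary.Construct.Closure.ReflexiveTransitive
  using (Star; ε; _◅_; _◅◅_; gmap; fold; reverse)
open import Relation.Nullary using (Dec; yes; no; ¬_; does)
open import Relation.Nullary.Decidable
  using (map′; _×-dec_; _⊎-dec_; ¬?; T?; dec-true; dec-false; does-⇔; decidable-stable)

-- Warshall's algorithm: `Via S x y` are the walks whose inner vertices lie in S, and admitting one
-- more vertex v only adds the walks that pass through v.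
module Warshall {A : Set} (_≟_ : DecidableEquality A)
                {vertices : List A} (∈-vertices : ∀ x → x ∈ vertices)
                {R : A → A → Set} (R? : ∀ x y → Dec (R x y)) where

  data Via (S : List A) : A → A → Set where
    stay : ∀ {x} → Via S x x
    edge : ∀ {x y} → R x y → Via S x y
    hop  : ∀ {x z y} → R x z → z ∈ S → Via S z y → Via S x y

  Via-weaken : ∀ {v S x y} → Via S x y → Via (v ∷ S) x y
  Via-weaken stay        = stay
  Via-weaken (edge r)    = edge r
  Via-weaken (hop r z w) = hop r (there z) (Via-weaken w)

  Via-join : ∀ {S x v y} → v ∈ S → Via S x v → Via S v y → Via S x y
  Via-join v stay        w = w
  Via-join v (edge r)    w = hop r v w
  Via-join v (hop r z u) w = hop r z (Via-join v u w)

  Via-split : ∀ {v S x y} → Via (v ∷ S) x y → Via S x y ⊎ (Via S x v × Via S v y)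
  Via-split stay     = inj₁ stay
  Via-split (edge r) = inj₁ (edge r)
  Via-split (hop r (here refl) w) with Via-split w
  ... | inj₁ w′       = inj₂ (edge r , w′)
  ... | inj₂ (_ , w′) = inj₂ (edge r , w′)
  Via-split (hop r (there z) w) with Via-split w
  ... | inj₁ w′        = inj₁ (hop r z w′)
  ... | inj₂ (w₁ , w₂) = inj₂ (hop r z w₁ , w₂)

  via? : ∀ S x y → Dec (Via S x y)
  via? [] x y = map′ [ (λ { refl → stay }) , edge ]′ direct (x ≟ y ⊎-dec R? x y)
    where
    direct : ∀ {x y} → Via [] x y → x ≡ y ⊎ R x y
    direct stay     = inj₁ refl
    direct (edge r) = inj₂ r
  via? (v ∷ S) x y =
    map′ [ Via-weaken , (λ (w₁ , w₂) → Via-join (here refl) (Via-weaken w₁) (Via-weaken w₂)) ]′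
         Via-split
         (via? S x y ⊎-dec (via? S x v ×-dec via? S v y))

  Star⇒Via : ∀ {x y} → Star R x y → Via vertices x y
  Star⇒Via ε       = stay
  Star⇒Via (r ◅ w) = hop r (∈-vertices _) (Star⇒Via w)

  Via⇒Star : ∀ {S x y} → Via S x y → Star R x y
  Via⇒Star stay        = ε
  Via⇒Star (edge r)    = r ◅ ε
  Via⇒Star (hop r _ w) = r ◅ Via⇒Star w

  star? : ∀ x y → Dec (Star R x y)
  star? x y = map′ Via⇒Star Star⇒Via (via? vertices x y)

-- `indicator c b` is 1 iff b ≡ c; it is written so that `indicator true` and `indicator false`
-- unfold to the summands of countRed and countBlue.
indicator : Bool → Bool → ℕ
indicator c b = if b then (if c then 1 else 0) else (if c then 0 else 1)

indicator≡0⇒ : ∀ c b → indicator c b ≡ 0 → b ≡ not c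
indicator≡0⇒ true  false _ = refl
indicator≡0⇒ false true  _ = refl

indicator≡1⇒ : ∀ c b → indicator c b ≡ 1 → b ≡ c
indicator≡1⇒ true  true  _ = refl
indicator≡1⇒ false false _ = refl

module _ {n : ℕ} (δ : Fin n → Fin n → Bool) where

  NACCycle : List (Fin n) → Set
  NACCycle vs = countRed δ es ≡ 0 ⊎ countBlue δ es ≡ 0 ⊎ (2 ≤ countRed δ es × 2 ≤ countBlue δ es)
    where es = cycleEdges vs

  colourCount : Bool → List (Pair n) → ℕ
  colourCount c []             = 0
  colourCount c ((u , v) ∷ es) = indicator c (δ u v) + colourCount c es

  countRed≡colourCount : ∀ es → countRed δ es ≡ colourCount true es
  countRed≡colourCount []             = refl
  countRed≡colourCount ((u , v) ∷ es) = cong₂ _+_ refl (countRed≡colourCount es)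

  countBlue≡colourCount : ∀ es → countBlue δ es ≡ colourCount false es
  countBlue≡colourCount []             = refl
  countBlue≡colourCount ((u , v) ∷ es) = cong₂ _+_ refl (countBlue≡colourCount es)

  noLonelyColour⇒NACCycle : ∀ vs → (∀ c → colourCount c (cycleEdges vs) ≢ 1) → NACCycle vs
  noLonelyColour⇒NACCycle vs lonely
    rewrite countRed≡colourCount (cycleEdges vs) | countBlue≡colourCount (cycleEdges vs)
    = classify (colourCount true (cycleEdges vs)) (colourCount false (cycleEdges vs))
               (lonely true) (lonely false)
    where
    classify : ∀ r b → r ≢ 1 → b ≢ 1 → r ≡ 0 ⊎ b ≡ 0 ⊎ (2 ≤ r × 2 ≤ b)
    classify zero          _             _   _   = inj₁ refl
    classify (suc zero)    _             r≢1 _   = ⊥-elim (r≢1 refl)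
    classify (suc (suc _)) zero          _   _   = inj₂ (inj₁ refl)
    classify (suc (suc _)) (suc zero)    _   b≢1 = ⊥-elim (b≢1 refl)
    classify (suc (suc _)) (suc (suc _)) _   _   = inj₂ (inj₂ (s≤s (s≤s z≤n) , s≤s (s≤s z≤n)))

  triangle-colours : ∀ a b c → NACCycle (a ∷ b ∷ c ∷ []) → δ a b ≡ δ b c × δ b c ≡ δ c a
  triangle-colours a b c h with δ a b | δ b c | δ c a | h
  ... | true  | true  | true  | _ = refl , refl
  ... | false | false | false | _ = refl , refl
  ... | true  | true  | false | inj₂ (inj₂ (_ , s≤s ()))
  ... | true  | false | true  | inj₂ (inj₂ (_ , s≤s ()))
  ... | false | true  | true  | inj₂ (inj₂ (_ , s≤s ()))
  ... | true  | false | false | inj₂ (inj₂ (s≤s () , _))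
  ... | false | true  | false | inj₂ (inj₂ (s≤s () , _))
  ... | false | false | true  | inj₂ (inj₂ (s≤s () , _))

  square-colours : ∀ a b c d → NACCycle (a ∷ b ∷ c ∷ d ∷ []) →
    δ a b ≡ δ c d ⊎ (δ a b ≡ δ b c × δ c d ≡ δ d a) ⊎ (δ a b ≡ δ d a × δ b c ≡ δ c d)
  square-colours a b c d h with δ a b | δ b c | δ c d | δ d a | h
  ... | true  | _     | true  | _     | _ = inj₁ refl
  ... | false | _     | false | _     | _ = inj₁ refl
  ... | true  | true  | false | false | _ = inj₂ (inj₁ (refl , refl))
  ... | false | false | true  | true  | _ = inj₂ (inj₁ (refl , refl))
  ... | true  | false | false | true  | _ = inj₂ (inj₂ (refl , refl))
  ... | false | true  | true  | false | _ = inj₂ (inj₂ (refl , refl))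
  ... | true  | true  | false | true  | inj₂ (inj₂ (_ , s≤s ()))
  ... | false | true  | true  | true  | inj₂ (inj₂ (_ , s≤s ()))
  ... | true  | false | false | false | inj₂ (inj₂ (s≤s () , _))
  ... | false | false | true  | false | inj₂ (inj₂ (s≤s () , _))

  -- cycleEdges (v ∷ vs) unfolds to walkEdges v vs v
  walkEdges : Fin n → List (Fin n) → Fin n → List (Pair n)
  walkEdges x ys z = zip (x ∷ ys) (ys ++ [ z ])

  module _ {E : AdjRel n} where

    colourCount≡0⇒walk : ∀ c x ys z → All (IsEdge E) (walkEdges x ys z) →
      colourCount c (walkEdges x ys z) ≡ 0 → Star (ColEdge E δ (not c)) x z
    colourCount≡0⇒walk c x [] z (e ∷ []) h with indicator c (δ x z) in eq | h
    ... | 0 | _ = (e , indicator≡0⇒ c _ eq) ◅ ε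
    colourCount≡0⇒walk c x (y ∷ ys) z (e ∷ es) h with indicator c (δ x y) in eq | h
    ... | 0 | h′ = (e , indicator≡0⇒ c _ eq) ◅ colourCount≡0⇒walk c y ys z es h′

    colourCount≡1⇒lonelyEdge : ∀ c x ys z → All (IsEdge E) (walkEdges x ys z) →
      colourCount c (walkEdges x ys z) ≡ 1 →
      ∃[ a ] ∃[ b ] (Star (ColEdge E δ (not c)) x a × ColEdge E δ c a b × Star (ColEdge E δ (not c)) b z)
    colourCount≡1⇒lonelyEdge c x [] z (e ∷ []) h with indicator c (δ x z) in eq | h
    ... | 1 | _ = x , z , ε , (e , indicator≡1⇒ c _ eq) , ε
    colourCount≡1⇒lonelyEdge c x (y ∷ ys) z (e ∷ es) h with indicator c (δ x y) in eq | h
    ... | 0 | h′ =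
      let a , b , before , ab , after = colourCount≡1⇒lonelyEdge c y ys z es h′
      in a , b , (e , indicator≡0⇒ c _ eq) ◅ before , ab , after
    ... | 1 | h′ = x , y , ε , (e , indicator≡1⇒ c _ eq) , colourCount≡0⇒walk c y ys z es (suc-injective h′)

module _ {n : ℕ} where

  ∈-pairs : ∀ (p : Pair n) → p ∈ cartesianProduct (allFin n) (allFin n)
  ∈-pairs (a , b) = ∈-cartesianProduct⁺ (∈-allFin a) (∈-allFin b)

  starOnPairs? : {R : Pair n → Pair n → Set} → (∀ p q → Dec (R p q)) → ∀ p q → Dec (Star R p q)
  starOnPairs? R? = Warshall.star? (≡-dec _≟ᶠ_ _≟ᶠ_) ∈-pairs R?

module _ {n : ℕ} {E : AdjRel n} where

  Cyc4-rotate : ∀ {a b c d} → Cyc4 E a b c d → Cyc4 E b c d a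
  Cyc4-rotate (a≢b , a≢c , a≢d , b≢c , b≢d , c≢d , ab , bc , cd , da) =
    b≢c , b≢d , ≢-sym a≢b , c≢d , ≢-sym a≢c , ≢-sym a≢d , bc , cd , da , ab

  triangle⇒IsCycle : ∀ {a b c} → a ≢ b → a ≢ c → b ≢ c →
    T (E a b) → T (E b c) → T (E c a) → IsCycle E (a ∷ b ∷ c ∷ [])
  triangle⇒IsCycle a≢b a≢c b≢c ab bc ca =
    s≤s (s≤s (s≤s z≤n)) , ((a≢b ∷ a≢c ∷ []) ∷ (b≢c ∷ []) ∷ [] ∷ []) , (ab ∷ bc ∷ ca ∷ [])

  Cyc4⇒IsCycle : ∀ {a b c d} → Cyc4 E a b c d → IsCycle E (a ∷ b ∷ c ∷ d ∷ [])
  Cyc4⇒IsCycle (a≢b , a≢c , a≢d , b≢c , b≢d , c≢d , ab , bc , cd , da) =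
    s≤s (s≤s (s≤s z≤n)) ,
    ((a≢b ∷ a≢c ∷ a≢d ∷ []) ∷ (b≢c ∷ b≢d ∷ []) ∷ (c≢d ∷ []) ∷ [] ∷ []) ,
    (ab ∷ bc ∷ cd ∷ da ∷ [])

  RibRel-sym : ∀ {f g} → RibRel E f g → RibRel E g f
  RibRel-sym = reverse λ { (opp C) → opp (Cyc4-rotate (Cyc4-rotate C)) ; flip → flip }

  cyc4? : ∀ a b c d → Dec (Cyc4 E a b c d)
  cyc4? a b c d =
    ¬? (a ≟ᶠ b) ×-dec ¬? (a ≟ᶠ c) ×-dec ¬? (a ≟ᶠ d) ×-dec ¬? (b ≟ᶠ c) ×-dec ¬? (b ≟ᶠ d) ×-dec
    ¬? (c ≟ᶠ d) ×-dec T? (E a b) ×-dec T? (E b c) ×-dec T? (E c d) ×-dec T? (E d a)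

  ribStep? : ∀ p q → Dec (RibStep E p q)
  ribStep? (a , b) (c , d) with cyc4? a b c d | ≡-dec _≟ᶠ_ _≟ᶠ_ (c , d) (b , a)
  ... | yes C  | _        = yes (opp C)
  ... | no ¬C  | yes refl = yes flip
  ... | no ¬C  | no ¬flip = no λ { (opp C) → ¬C C ; flip → ¬flip refl }

  inRib? : ∀ e a b → Dec (InRib E e a b)
  inRib? e a b = T? (E a b) ×-dec starOnPairs? ribStep? e (a , b)

  cartesian⇒sameColour : ∀ {δ} → IsCartesian E δ → ∀ {x y p q} → x ≢ y →
    Star (ColEdge E δ p) x y → Star (ColEdge E δ q) x y → p ≡ q
  cartesian⇒sameColour cart {p = true}  {true}  _   _ _ = refl
  cartesian⇒sameColour cart {p = false} {false} _   _ _ = refl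
  cartesian⇒sameColour cart {p = true}  {false} x≢y r b = ⊥-elim (cart _ _ x≢y (r , b))
  cartesian⇒sameColour cart {p = false} {true}  x≢y b r = ⊥-elim (cart _ _ x≢y (r , b))

  module _ (E-simple : IsSimple E) where

    edge-sym : ∀ {a b} → T (E a b) → T (E b a)
    edge-sym {a} {b} = subst T (proj₁ E-simple a b)

    edge⇒distinct : ∀ {a b} → T (E a b) → a ≢ b
    edge⇒distinct {a} aa refl = subst T (proj₂ E-simple a) aa

    Cyc4-reflect : ∀ {a b c d} → Cyc4 E a b c d → Cyc4 E a d c b
    Cyc4-reflect (a≢b , a≢c , a≢d , b≢c , b≢d , c≢d , ab , bc , cd , da) =
      a≢d , a≢c , a≢b , ≢-sym c≢d , ≢-sym b≢d , ≢-sym b≢c ,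
      edge-sym da , edge-sym cd , edge-sym bc , edge-sym ab

    Cyc4-merge : ∀ {a b x y x′ y′} → x ≢ x′ → Cyc4 E a x b y → Cyc4 E a x′ b y′ → Cyc4 E a x b x′
    Cyc4-merge x≢x′ (a≢x , a≢b , _ , x≢b , _ , _ , ax , xb , _ , _)
                    (a≢x′ , _ , _ , x′≢b , _ , _ , ax′ , x′b , _ , _) =
      a≢x , a≢b , a≢x′ , x≢b , x≢x′ , ≢-sym x′≢b , ax , xb , edge-sym x′b , edge-sym ax′

    module _ {δ : Fin n → Fin n → Bool} where

      reverse-colourWalk : (∀ u v → T (E u v) → δ u v ≡ δ v u) →
        ∀ {c x y} → Star (ColEdge E δ c) x y → Star (ColEdge E δ c) y x
      reverse-colourWalk δ-sym =
        reverse λ { {u} {v} (uv , col) → edge-sym uv , trans (sym (δ-sym u v uv)) col }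

      NAC-triangle : IsNAC E δ → ∀ {a b c} → a ≢ b → a ≢ c → b ≢ c →
        T (E a b) → T (E b c) → T (E c a) → δ a b ≡ δ c a
      NAC-triangle (_ , _ , _ , nacCycle) {a} {b} {c} a≢b a≢c b≢c ab bc ca =
        let ab≡bc , bc≡ca = triangle-colours δ a b c (nacCycle _ (triangle⇒IsCycle a≢b a≢c b≢c ab bc ca))
        in trans ab≡bc bc≡ca

      cartesianNAC-oppositeSides : IsNAC E δ → IsCartesian E δ →
        ∀ {a b c d} → Cyc4 E a b c d → δ a b ≡ δ c d
      cartesianNAC-oppositeSides (δ-sym , _ , _ , nacCycle) cart {a} {b} {c} {d}
        C@(_ , a≢c , _ , _ , b≢d , _ , ab , bc , cd , da)
        with square-colours δ a b c d (nacCycle _ (Cyc4⇒IsCycle C))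
      ... | inj₁ ab≡cd = ab≡cd
      ... | inj₂ (inj₁ (ab≡bc , cd≡da)) =
        cartesian⇒sameColour cart a≢c
          ((ab , refl) ◅ (bc , sym ab≡bc) ◅ ε)
          ((edge-sym da , trans (sym (δ-sym d a da)) (sym cd≡da)) ◅ (edge-sym cd , sym (δ-sym c d cd)) ◅ ε)
      ... | inj₂ (inj₂ (ab≡da , bc≡cd)) =
        trans (cartesian⇒sameColour cart b≢d
                ((edge-sym ab , sym (δ-sym a b ab)) ◅ (edge-sym da , trans (sym (δ-sym d a da)) (sym ab≡da)) ◅ ε)
                ((bc , refl) ◅ (cd , sym bc≡cd) ◅ ε))
              bc≡cd

module _ {n : ℕ} (G : BracedRibbonCutting n) where
  open BracedRibbonCutting G

  Ec⇒GE : ∀ {a b} → T (Ec a b) → T (GE G a b)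
  Ec⇒GE {a} {b} = Equivalence.from (T-∨ {Ec a b}) ∘ inj₁

  Ed⇒GE : ∀ {a b} → T (Ed a b) → T (GE G a b)
  Ed⇒GE {a} {b} = Equivalence.from (T-∨ {Ec a b}) ∘ inj₂

  GE-simple : IsSimple (GE G)
  GE-simple = (λ u v → cong₂ _∨_ (proj₁ Ec-simple u v) (proj₁ Ed-simple u v)) ,
              (λ u → cong₂ _∨_ (proj₂ Ec-simple u) (proj₂ Ed-simple u))

  Cyc4-Ec⇒GE : ∀ {a b c d} → Cyc4 Ec a b c d → Cyc4 (GE G) a b c d
  Cyc4-Ec⇒GE (a≢b , a≢c , a≢d , b≢c , b≢d , c≢d , ab , bc , cd , da) =
    a≢b , a≢c , a≢d , b≢c , b≢d , c≢d , Ec⇒GE ab , Ec⇒GE bc , Ec⇒GE cd , Ec⇒GE da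

  GRib-sym : ∀ {e a b} → GRib G e a b → GRib G e b a
  GRib-sym (inj₁ (ab , eab)) = inj₁ (edge-sym Ec-simple ab , eab ◅◅ (flip ◅ ε))
  GRib-sym (inj₂ (ab , x , y , C , ax , by)) =
    inj₂ (edge-sym Ed-simple ab , y , x , Cyc4-rotate (Cyc4-rotate C) , by , ax)

  edge⇒ribbon : ∀ {a b} → T (GE G a b) → ∃[ r ] (IsEdge Ec r × GRib G r a b)
  edge⇒ribbon {a} {b} ab with Equivalence.to (T-∨ {Ec a b}) ab
  ... | inj₁ ab∈Ec = (a , b) , ab∈Ec , inj₁ (ab∈Ec , ε)
  ... | inj₂ ab∈Ed with braces a b ab∈Ed
  ...   | x , y , C@(_ , _ , _ , _ , _ , _ , ax , _ , by , _) =
    (a , x) , ax , inj₂ (ab∈Ed , x , y , C , (ax , ε) , (by , opp C ◅ ε))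

  HasCartesianNAC : Set
  HasCartesianNAC = ∃[ δ ] (IsNAC (GE G) δ × IsCartesian (GE G) δ)

  RibbonsSeparate : Set
  RibbonsSeparate = ∀ (x y : Fin n) → x ≢ y → ∃[ e ] (IsEdge Ec e × Separates G e x y)

  BracingStep : Pair n → Pair n → Set
  BracingStep f g = IsEdge Ec f × IsEdge Ec g × (BracingAdj G f g ⊎ RibRel Ec f g)

  RibbonColouring : (Fin n → Fin n → Bool) → (Pair n → Bool) → Set
  RibbonColouring δ κ = ∀ {r a b} → IsEdge Ec r → GRib G r a b → δ a b ≡ κ r

  module _ {δ : Fin n → Fin n → Bool} {κ : Pair n → Bool} (δκ : RibbonColouring δ κ) where

    ribbonColouring-sym : ∀ u v → T (GE G u v) → δ u v ≡ δ v u
    ribbonColouring-sym u v uv =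
      let r , r∈Ec , uv∈r = edge⇒ribbon uv in trans (δκ r∈Ec uv∈r) (sym (δκ r∈Ec (GRib-sym uv∈r)))

    ribbonColouring-bracingStep : ∀ {f g} → BracingStep f g → κ f ≡ κ g
    ribbonColouring-bracingStep (f∈Ec , g∈Ec , inj₁ (_ , a , b , ab∈f , ab∈g)) =
      trans (sym (δκ f∈Ec ab∈f)) (δκ g∈Ec ab∈g)
    ribbonColouring-bracingStep (f∈Ec , g∈Ec , inj₂ fg) =
      trans (sym (δκ f∈Ec (inj₁ (g∈Ec , fg)))) (δκ g∈Ec (inj₁ (g∈Ec , ε)))

    ribbonColouring-bracingWalk : ∀ {f g} → Star BracingStep f g → κ f ≡ κ g
    ribbonColouring-bracingWalk = fold (λ f g → κ f ≡ κ g) (trans ∘ ribbonColouring-bracingStep) refl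

    colourWalk-avoids : ∀ {r c x y} → IsEdge Ec r → κ r ≢ c →
      Star (ColEdge (GE G) δ c) x y → Star (Without (GE G) (GRib G r)) x y
    colourWalk-avoids r∈Ec κr≢c =
      gmap (λ x → x) λ (uv , col) → uv , λ uv∈r → κr≢c (trans (sym (δκ r∈Ec uv∈r)) col)

    separated⇒ribbonColour : ∀ {r c x y} → IsEdge Ec r → Separates G r x y →
      Star (ColEdge (GE G) δ c) x y → κ r ≡ c
    separated⇒ribbonColour {r} {c} r∈Ec sep w =
      decidable-stable (κ r ≟ᵇ c) λ κr≢c → sep (colourWalk-avoids r∈Ec κr≢c w)

    module _ (separate : RibbonsSeparate) where

      ribbonColouring-cartesian : IsCartesian (GE G) δ
      ribbonColouring-cartesian x y x≢y (red , blue) with separate x y x≢y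
      ... | r , r∈Ec , sep
        with trans (sym (separated⇒ribbonColour r∈Ec sep red)) (separated⇒ribbonColour r∈Ec sep blue)
      ...   | ()

      ribbonColouring-noLonelyColour : ∀ vs → IsCycle (GE G) vs →
        ∀ c → colourCount δ c (cycleEdges vs) ≢ 1
      ribbonColouring-noLonelyColour (v ∷ vs) (_ , _ , edges) c once
        with colourCount≡1⇒lonelyEdge δ c v vs v edges once
      ... | a , b , before , ab@(ab∈G , _) , after with separate a b (edge⇒distinct GE-simple ab∈G)
      ...   | r , r∈Ec , sep =
        not-¬ (separated⇒ribbonColour r∈Ec sep (ab ◅ ε))
              (separated⇒ribbonColour r∈Ec sep
                (reverse-colourWalk GE-simple ribbonColouring-sym (after ◅◅ before)))

      ribbonColouring-NAC : ∀ {r s} → IsEdge Ec r → κ r ≡ true → IsEdge Ec s → κ s ≡ false →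
        IsNAC (GE G) δ
      ribbonColouring-NAC {r} {s} r∈Ec red s∈Ec blue =
        ribbonColouring-sym ,
        (proj₁ r , proj₂ r , Ec⇒GE r∈Ec , trans (δκ r∈Ec (inj₁ (r∈Ec , ε))) red) ,
        (proj₁ s , proj₂ s , Ec⇒GE s∈Ec , trans (δκ s∈Ec (inj₁ (s∈Ec , ε))) blue) ,
        λ vs cycle → noLonelyColour⇒NACCycle δ vs (ribbonColouring-noLonelyColour vs cycle)

  module _ {δ : Fin n → Fin n → Bool} (nac : IsNAC (GE G) δ) (cart : IsCartesian (GE G) δ) where

    cartesianNAC-ribRel : ∀ {f g} → IsEdge Ec f → RibRel Ec f g → uncurry δ f ≡ uncurry δ g
    cartesianNAC-ribRel f∈Ec ε = refl
    cartesianNAC-ribRel f∈Ec (opp C@(_ , _ , _ , _ , _ , _ , _ , _ , cd , _) ◅ rest) =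
      trans (cartesianNAC-oppositeSides GE-simple nac cart (Cyc4-Ec⇒GE C)) (cartesianNAC-ribRel cd rest)
    cartesianNAC-ribRel {a , b} ab (flip ◅ rest) =
      trans (proj₁ nac a b (Ec⇒GE ab)) (cartesianNAC-ribRel (edge-sym Ec-simple ab) rest)

    cartesianNAC-ribbonColouring : RibbonColouring δ (uncurry δ)
    cartesianNAC-ribbonColouring r∈Ec (inj₁ (_ , rab)) = sym (cartesianNAC-ribRel r∈Ec rab)
    cartesianNAC-ribbonColouring {r} {a} {b} r∈Ec
      (inj₂ (ab , x , _ , (a≢x , a≢b , _ , x≢b , _ , _ , ax , xb , _ , _) , (_ , rax) , _)) =
      begin
        δ a b  ≡⟨ proj₁ nac a b (Ed⇒GE ab) ⟩
        δ b a  ≡⟨ sym (NAC-triangle GE-simple nac a≢x a≢b x≢b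
                         (Ec⇒GE ax) (Ec⇒GE xb) (Ed⇒GE (edge-sym Ed-simple ab))) ⟩
        δ a x  ≡⟨ sym (cartesianNAC-ribRel r∈Ec rax) ⟩
        uncurry δ r ∎
      where open ≡-Reasoning

  bracingConnected⇒noCartesianNAC : BracingConnected G → ¬ HasCartesianNAC
  bracingConnected⇒noCartesianNAC connected
    (δ , nac@(_ , (u , v , uv , red) , (u′ , v′ , uv′ , blue) , _) , cart)
    with edge⇒ribbon uv | edge⇒ribbon uv′
  ... | r , r∈Ec , uv∈r | s , s∈Ec , uv′∈s with
    begin
      true        ≡⟨ sym red ⟩
      δ u v       ≡⟨ δκ r∈Ec uv∈r ⟩
      uncurry δ r ≡⟨ ribbonColouring-bracingWalk δκ (connected r s r∈Ec s∈Ec) ⟩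
      uncurry δ s ≡⟨ sym (δκ s∈Ec uv′∈s) ⟩
      δ u′ v′     ≡⟨ blue ⟩
      false       ∎
    where open ≡-Reasoning
          δκ = cartesianNAC-ribbonColouring nac cart
  ... | ()

  -- the brace ab lies in the ribbons of both side classes of the square a x b y
  bracedSquare-bracingAdj : ∀ {a x b y} → Cyc4 Ec a x b y → T (Ed a b) → BracingAdj G (b , x) (a , x)
  bracedSquare-bracingAdj {a} {x} {b} {y} C@(_ , _ , _ , _ , _ , _ , ax , xb , by , ya) ab =
    (a , y , b , x , Cyc4-Ec⇒GE C′ , inj₁ ay∈bx , inj₁ bx∈bx , inj₁ (ax , ε) ,
       inj₁ (edge-sym Ec-simple by , opp C ◅ flip ◅ ε)) ,
    a , b , inj₂ (ab , y , x , C′ , ay∈bx , bx∈bx) , inj₂ (ab , x , y , C , (ax , ε) , (by , opp C ◅ ε))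
    where
    C′ : Cyc4 Ec a y b x
    C′ = Cyc4-reflect Ec-simple C
    ay∈bx : InRib Ec (b , x) a y
    ay∈bx = edge-sym Ec-simple ya , opp (Cyc4-rotate (Cyc4-rotate C′)) ◅ ε
    bx∈bx : InRib Ec (b , x) b x
    bx∈bx = edge-sym Ec-simple xb , ε

  sharedEdge⇒bracingWalk : ∀ {r s a b} → IsEdge Ec r → IsEdge Ec s →
    GRib G r a b → GRib G s a b → Star BracingStep r s
  sharedEdge⇒bracingWalk r∈Ec s∈Ec (inj₁ (_ , rab)) (inj₁ (_ , sab)) =
    (r∈Ec , s∈Ec , inj₂ (rab ◅◅ RibRel-sym sab)) ◅ ε
  sharedEdge⇒bracingWalk _ _ (inj₁ (ab , _)) (inj₂ (ab′ , _)) = ⊥-elim (disjoint _ _ (ab , ab′))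
  sharedEdge⇒bracingWalk _ _ (inj₂ (ab′ , _)) (inj₁ (ab , _)) = ⊥-elim (disjoint _ _ (ab , ab′))
  sharedEdge⇒bracingWalk r∈Ec s∈Ec (inj₂ (ab , x , _ , C , (_ , rax) , _))
                         (inj₂ (_ , x′ , _ , C′@(_ , _ , _ , _ , _ , _ , _ , x′b , _ , _) , (ax′ , sax′) , _))
    with x ≟ᶠ x′
  ... | yes refl = (r∈Ec , s∈Ec , inj₂ (rax ◅◅ RibRel-sym sax′)) ◅ ε
  ... | no x≢x′ =
    (r∈Ec , bx′ , inj₂ (rax ◅◅ opp (Cyc4-merge Ec-simple x≢x′ C C′) ◅ ε)) ◅
    (bx′ , ax′ , inj₁ (bracedSquare-bracingAdj C′ ab)) ◅
    (ax′ , s∈Ec , inj₂ (RibRel-sym sax′)) ◅ ε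
    where bx′ = edge-sym Ec-simple x′b

  gRib? : ∀ e a b → Dec (GRib G e a b)
  gRib? e a b = inRib? e a b ⊎-dec (T? (Ed a b) ×-dec
    any? λ x → any? λ y → cyc4? a x b y ×-dec inRib? e a x ×-dec inRib? e b y)

  bracingStep? : ∀ f g → Dec (BracingStep f g)
  bracingStep? f g =
    T? (uncurry Ec f) ×-dec T? (uncurry Ec g) ×-dec (bracingAdj? ⊎-dec starOnPairs? (ribStep? {E = Ec}) f g)
    where
    bracingAdj? : Dec (BracingAdj G f g)
    bracingAdj? =
      (any? λ u₁ → any? λ u₂ → any? λ u₃ → any? λ u₄ →
        cyc4? {E = GE G} u₁ u₂ u₃ u₄ ×-dec
        gRib? f u₁ u₂ ×-dec gRib? f u₃ u₄ ×-dec gRib? g u₁ u₄ ×-dec gRib? g u₂ u₃)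
      ×-dec (any? λ a → any? λ b → gRib? f a b ×-dec gRib? g a b)

  bracingWalk? : ∀ f g → Dec (Star BracingStep f g)
  bracingWalk? = starOnPairs? bracingStep?

  module ComponentColouring (e₀ : Pair n) where

    κ : Pair n → Bool
    κ r = does (bracingWalk? e₀ r)

    InComponent : Fin n → Fin n → Set
    InComponent a b = ∃[ i ] ∃[ j ] (T (Ec i j) × Star BracingStep e₀ (i , j) × GRib G (i , j) a b)

    inComponent? : ∀ a b → Dec (InComponent a b)
    inComponent? a b =
      any? λ i → any? λ j → T? (Ec i j) ×-dec bracingWalk? e₀ (i , j) ×-dec gRib? (i , j) a b

    δ : Fin n → Fin n → Bool
    δ a b = does (inComponent? a b)

    δκ : RibbonColouring δ κ
    δκ {r} {a} {b} r∈Ec abr =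
      does-⇔ (mk⇔ inComponent⇒reached reached⇒inComponent) (inComponent? a b) (bracingWalk? e₀ r)
      where
      inComponent⇒reached : InComponent a b → Star BracingStep e₀ r
      inComponent⇒reached (_ , _ , ij , w , abij) = w ◅◅ sharedEdge⇒bracingWalk ij r∈Ec abij abr
      reached⇒inComponent : Star BracingStep e₀ r → InComponent a b
      reached⇒inComponent w = proj₁ r , proj₂ r , r∈Ec , w , abr

  disconnected⇒cartesianNAC : RibbonsSeparate → ∀ {e₀ e₁} → IsEdge Ec e₀ → IsEdge Ec e₁ →
    ¬ Star BracingStep e₀ e₁ → HasCartesianNAC
  disconnected⇒cartesianNAC separate {e₀} {e₁} e₀∈Ec e₁∈Ec apart =
    δ ,
    ribbonColouring-NAC δκ separate
      e₀∈Ec (dec-true (bracingWalk? e₀ e₀) ε) e₁∈Ec (dec-false (bracingWalk? e₀ e₁) apart) ,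
    ribbonColouring-cartesian δκ separate
    where open ComponentColouring e₀

  noCartesianNAC⇒bracingConnected : RibbonsSeparate → ¬ HasCartesianNAC → BracingConnected G
  noCartesianNAC⇒bracingConnected separate noNAC e₀ e₁ e₀∈Ec e₁∈Ec =
    decidable-stable (bracingWalk? e₀ e₁) (noNAC ∘ disconnected⇒cartesianNAC separate e₀∈Ec e₁∈Ec)

theorem4p5 : (n : ℕ) (G : BracedRibbonCutting n) →
    (∀ (x y : Fin n) → x ≢ y →
      ∃[ e ] (IsEdge (BracedRibbonCutting.Ec G) e × Separates G e x y)) →
    (BracingConnected G ⇔ (¬ (∃[ δ ] (IsNAC (GE G) δ × IsCartesian (GE G) δ))))
theorem4p5 n G separate =
  mk⇔ (bracingConnected⇒noCartesianNAC G) (noCartesianNAC⇒bracingConnected G separate)
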